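{- Let $\mathcal{G}$ be a connected $k$-uniform hypergraph on vertex set $[n]$, and let $\mathcal{L}_{\mathcal{G}}$ be its Laplacian tensor. Then $\beta(\mathcal{G})=1$, i.e. the maximum number of linearly independent nonnegative eigenvectors of $\mathcal{L}_{\mathcal{G}}$ corresponding to the eigenvalue $0$ is $1$.
   Context: A $k$-uniform hypergraph $\mathcal{G}$ has vertex set $V(\mathcal{G})=[n]=\{1,\dots,n\}$ and an edge set $E(\mathcal{G})$ of $k$-element subsets of $[n]$; $d_i$ is the number of edges containing vertex $i$. A path is an alternating sequence $v_0e_1v_1\cdots e_lv_l$ of distinct vertices and distinct edges with $v_{i-1},v_i\in e_i$; $\mathcal{G}$ is connected if any two vertices are joined by a path. The adjacency tensor $\mathcal{A}_{\mathcal{G}}=(a_{i_1\cdots i_k})$ is the $k$-order $n$-dimensional tensor with $a_{i_1\cdots i_k}=\frac{1}{(k-1)!}$ if $\{i_1,\dots,i_k\}\in E(\mathcal{G})$ and $0$ otherwise. The Laplacian tensor is $\mathcal{L}_{\mathcal{G}}=\mathcal{D}_{\mathcal{G}}-\mathcal{A}_{\mathcal{G}}$, where $\mathcal{D}_{\mathcal{G}}$ is the diagonal $k$-order tensor with diagonal entries $d_1,\dots,d_n$. For a $k$-order $n$-dimensional tensor $\mathcal{T}=(t_{i_1\cdots i_k})$ and $x\in\mathbb{C}^n$, $\mathcal{T}x^{k-1}\in\mathbb{C}^n$ has $i$-th entry $\sum_{i_2,\dots,i_k=1}^n t_{i i_2\cdots i_k}x_{i_2}\cdots x_{i_k}$;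 $\lambda\in\mathbb{C}$ is an eigenvalue with eigenvector $x\neq 0$ if $\mathcal{T}x^{k-1}=\lambda x^{[k-1]}$, where $x^{[k-1]}=(x_1^{k-1},\dots,x_n^{k-1})^{\mathrm T}$. The geometry connectivity $\beta(\mathcal{G})$ is the maximum number of linearly independent nonnegative vectors $x\in\mathbb{R}^n_+\setminus\{0\}$ with $\mathcal{L}_{\mathcal{G}}x^{k-1}=0$. -}

module Defs where

open import Level using (Level; _⊔_)
open import Data.Nat as ℕ using (ℕ; zero; suc; _∸_)
open import Data.Nat using (_!)
open import Data.Bool using (Bool; true; false; if_then_else_; _∧_; _∨_)
open import Data.Fin as Fin using (Fin; inject₁; fromℕ)
open import Data.Fin.Subset using (Subset; ⁅_⁆; _∪_; ⊥)
open import Data.Vec as Vec using (Vec; []; _∷_; lookup)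
import Data.Vec.Properties as VecP
open import Data.List as List using (List; []; _∷_; foldr; map; allFin; concatMap; filter; length)
open import Data.Bool.ListAction using (any)
open import Data.List.Relation.Unary.Any using (Any)
open import Data.Product using (Σ; _×_; _,_; ∃)
open import Relation.Nullary using (¬_)
open import Relation.Nullary.Decidable using (⌊_⌋)
open import Relation.Binary.PropositionalEquality using (_≡_)
open import Relation.Binary using (Rel; IsTotalOrder)
open import Function.Definitions using (Injective)
open import Algebra.Structures using (IsCommutativeRing)

-- The real numbers, axiomatised as a (Dedekind-)complete ordered field.
-- Any model of this record is (isomorphic to) ℝ.

record RealField (c ℓ : Level) : Set (Level.suc (c ⊔ ℓ)) where
  infixl 7 _*_
  infixl 6 _+_
  infix  4 _≈_ _≤_
  field
    Carrier  : Set c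
    _≈_      : Rel Carrier ℓ
    _≤_      : Rel Carrier ℓ
    _+_      : Carrier → Carrier → Carrier
    _*_      : Carrier → Carrier → Carrier
    -_       : Carrier → Carrier
    0#       : Carrier
    1#       : Carrier
    _⁻¹      : Carrier → Carrier
    isCommutativeRing : IsCommutativeRing _≈_ _+_ _*_ -_ 0# 1#
    0≉1      : ¬ (0# ≈ 1#)
    ⁻¹-inverse : ∀ x → ¬ (x ≈ 0#) → x * (x ⁻¹) ≈ 1#
    isTotalOrder : IsTotalOrder _≈_ _≤_
    +-mono-≤ : ∀ {x y} z → x ≤ y → x + z ≤ y + z
    *-nonneg : ∀ {x y} → 0# ≤ x → 0# ≤ y → 0# ≤ x * y
    complete : (P : Carrier → Set c) → ∃ P → (∃ λ b → ∀ x → P x → x ≤ b) →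
               ∃ λ s → (∀ x → P x → x ≤ s) × (∀ b → (∀ x → P x → x ≤ b) → s ≤ b)

  _-_ : Carrier → Carrier → Carrier
  x - y = x + (- y)

-- Hypergraphs on vertex set [n] = Fin n, with edge set given as a
-- duplicate-free list of subsets of Fin n.

Uniform : (n k : ℕ) → List (Subset n) → Set
Uniform n k E = Data.List.Relation.Unary.All.All (λ e → Data.Fin.Subset.∣ e ∣ ≡ k) E
  where import Data.List.Relation.Unary.All
        import Data.Fin.Subset

_∈E_ : ∀ {n} → Subset n → List (Subset n) → Set
e ∈E E = Any (e ≡_) E

record Path {n : ℕ} (E : List (Subset n)) (u w : Fin n) : Set where
  field
    l     : ℕ
    v     : Fin (suc l) → Fin n
    e     : Fin l → Subset n
    v-inj : Injective _≡_ _≡_ v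
    e-inj : Injective _≡_ _≡_ e
    e∈E   : ∀ j → e j ∈E E
    v-in-left  : ∀ j → lookup (e j) (v (inject₁ j)) ≡ true
    v-in-right : ∀ j → lookup (e j) (v (Fin.suc j)) ≡ true
    start : v Fin.zero ≡ u
    end   : v (fromℕ l) ≡ w

Connected : (n : ℕ) → List (Subset n) → Set
Connected n E = ∀ (u w : Fin n) → Path E u w

degree : ∀ {n} → List (Subset n) → Fin n → ℕ
degree E i = length (filter (λ e → lookup e i Data.Bool.≟ true) E)
  where import Data.Bool

entries : ∀ {n m} → Vec (Fin n) m → Subset n
entries []       = ⊥
entries (i ∷ is) = ⁅ i ⁆ ∪ entries is

isEdge : ∀ {n} → List (Subset n) → Subset n → Bool
isEdge E s = any (λ e → ⌊ VecP.≡-dec Data.Bool._≟_ e s ⌋) E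
  where import Data.Bool

allIdx : (n m : ℕ) → List (Vec (Fin n) m)
allIdx n zero    = [] ∷ []
allIdx n (suc m) = concatMap (λ i → map (i ∷_) (allIdx n m)) (allFin n)

allEq : ∀ {n m} → Fin n → Vec (Fin n) m → Bool
allEq i []       = true
allEq i (j ∷ js) = ⌊ i Fin.≟ j ⌋ ∧ allEq i js

module _ {c ℓ} (R : RealField c ℓ) where
  open RealField R

  fromℕ' : ℕ → Carrier
  fromℕ' zero    = 0#
  fromℕ' (suc m) = 1# + fromℕ' m

  Tensor : ℕ → ℕ → Set c
  Tensor k n = Vec (Fin n) k → Carrier

  sumL : List Carrier → Carrier
  sumL = foldr _+_ 0#

  prodL : List Carrier → Carrier
  prodL = foldr _*_ 1#

  apply : ∀ {k n} → Tensor k n → (Fin n → Carrier) → Fin n → Carrier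
  apply {zero}  {n} T x i = 0#
  apply {suc m} {n} T x i =
    sumL (map (λ js → T (i ∷ js) * prodL (List.map x (Vec.toList js))) (allIdx n m))

  adjacency : (n k : ℕ) → List (Subset n) → Tensor k n
  adjacency n k E is =
    if isEdge E (entries is) then (fromℕ' ((k ∸ 1) !)) ⁻¹ else 0#

  degreeTensor : (n k : ℕ) → List (Subset n) → Tensor k n
  degreeTensor n k E []       = 0#
  degreeTensor n k E (i ∷ is) = if allEq i is then fromℕ' (degree E i) else 0#

  laplacian : (n k : ℕ) → List (Subset n) → Tensor k n
  laplacian n k E is = degreeTensor n k E is - adjacency n k E is

  Nonneg : ∀ {n} → (Fin n → Carrier) → Set ℓ
  Nonneg x = ∀ i → 0# ≤ x i

  NonzeroV : ∀ {n} → (Fin n → Carrier) → Set ℓ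
  NonzeroV x = ¬ (∀ i → x i ≈ 0#)

  NonnegKernelVec : (n k : ℕ) → List (Subset n) → (Fin n → Carrier) → Set ℓ
  NonnegKernelVec n k E x =
    Nonneg x × NonzeroV x × (∀ i → apply (laplacian n k E) x i ≈ 0#)

  LinIndep : ∀ {n m} → (Fin m → Fin n → Carrier) → Set (c ⊔ ℓ)
  LinIndep {n} {m} v = ∀ (a : Fin m → Carrier) →
    (∀ i → sumL (List.map (λ j → a j * v j i) (allFin m)) ≈ 0#) → ∀ j → a j ≈ 0#

  HasIndepFamily : (n k : ℕ) → List (Subset n) → ℕ → Set (c ⊔ ℓ)
  HasIndepFamily n k E m = Σ (Fin m → Fin n → Carrier) λ v →
    (∀ j → NonnegKernelVec n k E (v j)) × LinIndep v

  GeometryConnectivityIs : (n k : ℕ) → List (Subset n) → ℕ → Set (c ⊔ ℓ)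
  GeometryConnectivityIs n k E b =
    HasIndepFamily n k E b × (∀ m → HasIndepFamily n k E m → m ℕ.≤ b)

-- A nonnegative vector x in the kernel of the Laplacian is constant. Let M > 0 be its maximum,
-- attained at i. The i-th kernel equation says that d_i M^(k-1) equals the sum, over index
-- vectors (i₂, …, i_k) which together with i list an edge, of x_{i₂} ⋯ x_{i_k} / (k-1)!. Every
-- edge through i is listed by exactly (k-1)! such vectors and every product is at most
-- M^(k-1), so all of them equal M^(k-1): x is maximal on every edge through i, hence, by
-- connectivity, everywhere. Any two nonnegative kernel vectors are therefore proportional,
-- and the all-ones vector is one of them.

module Submission where

open import Function using (_∘_; id)
open import Data.Nat as ℕ using (ℕ; zero; suc; _!; z≤n; s≤s)
import Data.Nat.Properties as ℕₚ
open import Data.Bool as Bool using (Bool; true; false; _∨_; if_then_else_)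
import Data.Bool.Properties as Boolₚ
open import Data.Fin as Fin using (Fin; zero; suc)
import Data.Fin.Properties as Finₚ
open import Data.Fin.Induction using (<-weakInduction)
open import Data.Fin.Subset using (Subset; ⁅_⁆; _∪_; _∩_; ∁; ∣_∣; _∈_; _∉_; _⊆_)
open import Data.Fin.Subset.Properties
  using (∪-assoc; ∪-identityʳ; ∣⁅x⁆∣≡1; x∈⁅x⁆; x∈⁅y⁆⇒x≡y; x∈p∪q⁺; x∈p∪q⁻; x∈p∩q⁺; x∈p∩q⁻;
         x∈p⇒x∉∁p; x∉p⇒x∈∁p; _∈?_; ∉⊥; ⊆-antisym; p⊆q⇒∣p∣≤∣q∣; drop-∷-⊆; drop-not-there)
open import Data.Vec as Vec using (Vec; []; _∷_; lookup; here; there)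
import Data.Vec.Properties as Vecₚ
open import Data.List using (List; []; _∷_; map; _++_; allFin; concatMap)
import Data.List.Properties as Listₚ
open import Data.List.Relation.Unary.Any using (Any; here; there)
open import Data.List.Relation.Unary.All as All using (All; []; _∷_)
open import Data.List.Relation.Unary.AllPairs using ([]; _∷_)
open import Data.List.Relation.Unary.Unique.Propositional using (Unique)
open import Data.Product using (Σ; ∃; _×_; _,_; proj₁; proj₂; map₂)
open import Data.Sum using (inj₁; inj₂)
open import Relation.Nullary using (¬_; yes; no; contradiction)
open import Relation.Nullary.Decidable using (⌊_⌋)
open import Relation.Binary using (IsTotalOrder)
open import Relation.Binary.PropositionalEquality
  using (_≡_; _≢_; refl; sym; trans; cong; cong₂; subst; module ≡-Reasoning)
open import Algebra.Bundles using (CommutativeRing)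
import Algebra.Properties.Ring as RingProperties
import Algebra.Properties.CommutativeSemigroup as CommutativeSemigroupProperties
import Relation.Binary.Reasoning.Setoid as SetoidReasoning
open import Defs

module Combinatorics where

  open import Data.Nat using (_+_; _*_; _<_; _≤_)
  open import Data.Nat.ListAction using (sum)

  private
    module ℕ+ = CommutativeSemigroupProperties ℕₚ.+-commutativeSemigroup
    variable
      n m : ℕ

  indicator : Bool → ℕ
  indicator true  = 1
  indicator false = 0

  count : ∀ {a} {A : Set a} → (A → Bool) → List A → ℕ
  count p []       = 0
  count p (x ∷ xs) = indicator (p x) + count p xs

  module _ {a} {A : Set a} where

    count-cong : ∀ {p q : A → Bool} → (∀ x → p x ≡ q x) → ∀ xs → count p xs ≡ count q xs
    count-cong p≗q []       = refl
    count-cong p≗q (x ∷ xs) = cong₂ _+_ (cong indicator (p≗q x)) (count-cong p≗q xs)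

    count-none : ∀ {p : A → Bool} → (∀ x → p x ≡ false) → ∀ xs → count p xs ≡ 0
    count-none none []       = refl
    count-none none (x ∷ xs) rewrite none x = count-none none xs

    count-++ : ∀ (p : A → Bool) xs ys → count p (xs ++ ys) ≡ count p xs + count p ys
    count-++ p []       ys = refl
    count-++ p (x ∷ xs) ys =
      trans (cong (indicator (p x) +_) (count-++ p xs ys)) (sym (ℕₚ.+-assoc (indicator (p x)) _ _))

    count-∨ : ∀ (p q : A → Bool) → (∀ x → p x ≡ true → q x ≡ false) → ∀ xs →
              count (λ x → p x ∨ q x) xs ≡ count p xs + count q xs
    count-∨ p q disjoint []       = refl
    count-∨ p q disjoint (x ∷ xs) with p x in px
    ... | true  rewrite disjoint x px = cong suc (count-∨ p q disjoint xs)
    ... | false = trans (cong (indicator (q x) +_) (count-∨ p q disjoint xs))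
                        (ℕ+.x∙yz≈y∙xz (indicator (q x)) (count p xs) (count q xs))

    sum-indicator : ∀ (f : A → ℕ) (p : A → Bool) k → (∀ x → f x ≡ indicator (p x) * k) →
                    ∀ xs → sum (map f xs) ≡ count p xs * k
    sum-indicator f p k f≗ []       = refl
    sum-indicator f p k f≗ (x ∷ xs) =
      trans (cong₂ _+_ (f≗ x) (sum-indicator f p k f≗ xs))
            (sym (ℕₚ.*-distribʳ-+ k (indicator (p x)) (count p xs)))

    count>0⇒∃ : ∀ (p : A → Bool) xs → 0 < count p xs → ∃ λ x → Any (x ≡_) xs × p x ≡ true
    count>0⇒∃ p (x ∷ xs) count>0 with p x in px
    ... | true  = x , here refl , px
    ... | false with count>0⇒∃ p xs count>0
    ...   | y , y∈xs , py = y , there y∈xs , py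

  module _ {a b} {A : Set a} {B : Set b} where

    count-map : ∀ (p : B → Bool) (f : A → B) xs → count p (map f xs) ≡ count (p ∘ f) xs
    count-map p f []       = refl
    count-map p f (x ∷ xs) = cong (indicator (p (f x)) +_) (count-map p f xs)

    count-concatMap : ∀ (p : B → Bool) (f : A → List B) xs →
                      count p (concatMap f xs) ≡ sum (map (count p ∘ f) xs)
    count-concatMap p f []       = refl
    count-concatMap p f (x ∷ xs) =
      trans (count-++ p (f x) (concatMap f xs)) (cong (count p (f x) +_) (count-concatMap p f xs))

  sum-cong : ∀ {a} {A : Set a} {f g : A → ℕ} → (∀ x → f x ≡ g x) → ∀ xs → sum (map f xs) ≡ sum (map g xs)
  sum-cong f≗g xs = cong sum (Listₚ.map-cong f≗g xs)

  count-allIdx-suc : ∀ {n m} (p : Vec (Fin n) (suc m) → Bool) →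
    count p (allIdx n (suc m)) ≡ sum (map (λ j → count (p ∘ (j ∷_)) (allIdx n m)) (allFin n))
  count-allIdx-suc {n} {m} p =
    trans (count-concatMap p (λ j → map (j ∷_) (allIdx n m)) (allFin n))
          (sum-cong (λ j → count-map p (j ∷_) (allIdx n m)) (allFin n))

  allFin-suc : ∀ n → allFin (suc n) ≡ Fin.zero ∷ map Fin.suc (allFin n)
  allFin-suc n = cong (Fin.zero ∷_) (sym (Listₚ.map-tabulate id Fin.suc))

  count-lookup-allFin : ∀ {n} (p : Subset n) → count (lookup p) (allFin n) ≡ ∣ p ∣
  count-lookup-allFin []      = refl
  count-lookup-allFin {suc n} (b ∷ p) = begin
    count (lookup (b ∷ p)) (allFin (suc n))
      ≡⟨ cong (count (lookup (b ∷ p))) (allFin-suc n) ⟩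
    indicator b + count (lookup (b ∷ p)) (map Fin.suc (allFin n))
      ≡⟨ cong (indicator b +_) (trans (count-map _ Fin.suc (allFin n)) (count-lookup-allFin p)) ⟩
    indicator b + ∣ p ∣
      ≡⟨ ∣b∷p∣ b ⟩
    ∣ b ∷ p ∣ ∎
    where
    open ≡-Reasoning
    ∣b∷p∣ : ∀ b → indicator b + ∣ p ∣ ≡ ∣ b ∷ p ∣
    ∣b∷p∣ true  = refl
    ∣b∷p∣ false = refl

  ∈⇒lookup≡true : ∀ {x : Fin n} {p} → x ∈ p → lookup p x ≡ true
  ∈⇒lookup≡true = Vecₚ.[]=⇒lookup

  ∉⇒lookup≡false : ∀ {x : Fin n} {p} → x ∉ p → lookup p x ≡ false
  ∉⇒lookup≡false {x = x} {p = p} x∉p with lookup p x in eq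
  ... | true  = contradiction (Vecₚ.lookup⇒[]= x p eq) x∉p
  ... | false = refl

  x∈p⇒p∪⁅x⁆≡p : ∀ {x : Fin n} {p} → x ∈ p → p ∪ ⁅ x ⁆ ≡ p
  x∈p⇒p∪⁅x⁆≡p {p = _ ∷ p} here      = cong (true ∷_) (∪-identityʳ p)
  x∈p⇒p∪⁅x⁆≡p {p = b ∷ _} (there x∈p) = cong₂ _∷_ (Boolₚ.∨-identityʳ b) (x∈p⇒p∪⁅x⁆≡p x∈p)

  x∉p⇒∣p∪⁅x⁆∣≡1+∣p∣ : ∀ {x : Fin n} {p} → x ∉ p → ∣ p ∪ ⁅ x ⁆ ∣ ≡ suc ∣ p ∣
  x∉p⇒∣p∪⁅x⁆∣≡1+∣p∣ {x = zero}  {true  ∷ p} x∉p = contradiction here x∉p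
  x∉p⇒∣p∪⁅x⁆∣≡1+∣p∣ {x = zero}  {false ∷ p} x∉p = cong (suc ∘ ∣_∣) (∪-identityʳ p)
  x∉p⇒∣p∪⁅x⁆∣≡1+∣p∣ {x = suc x} {true  ∷ p} x∉p = cong suc (x∉p⇒∣p∪⁅x⁆∣≡1+∣p∣ (drop-not-there x∉p))
  x∉p⇒∣p∪⁅x⁆∣≡1+∣p∣ {x = suc x} {false ∷ p} x∉p = x∉p⇒∣p∪⁅x⁆∣≡1+∣p∣ (drop-not-there x∉p)

  ∣p∪⁅x⁆∣≤1+∣p∣ : ∀ (p : Subset n) x → ∣ p ∪ ⁅ x ⁆ ∣ ≤ suc ∣ p ∣
  ∣p∪⁅x⁆∣≤1+∣p∣ p x with x ∈? p
  ... | yes x∈p = ℕₚ.≤-trans (ℕₚ.≤-reflexive (cong ∣_∣ (x∈p⇒p∪⁅x⁆≡p x∈p))) (ℕₚ.n≤1+n ∣ p ∣)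
  ... | no  x∉p = ℕₚ.≤-reflexive (x∉p⇒∣p∪⁅x⁆∣≡1+∣p∣ x∉p)

  ∣p∪entries∣≤∣p∣+m : (p : Subset n) (xs : Vec (Fin n) m) → ∣ p ∪ entries xs ∣ ≤ ∣ p ∣ + m
  ∣p∪entries∣≤∣p∣+m p []       =
    ℕₚ.≤-reflexive (trans (cong ∣_∣ (∪-identityʳ p)) (sym (ℕₚ.+-identityʳ ∣ p ∣)))
  ∣p∪entries∣≤∣p∣+m {m = suc m} p (x ∷ xs) = begin
    ∣ p ∪ (⁅ x ⁆ ∪ entries xs) ∣  ≡⟨ cong ∣_∣ (∪-assoc p ⁅ x ⁆ (entries xs)) ⟨
    ∣ (p ∪ ⁅ x ⁆) ∪ entries xs ∣  ≤⟨ ∣p∪entries∣≤∣p∣+m (p ∪ ⁅ x ⁆) xs ⟩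
    ∣ p ∪ ⁅ x ⁆ ∣ + m             ≤⟨ ℕₚ.+-monoˡ-≤ m (∣p∪⁅x⁆∣≤1+∣p∣ p x) ⟩
    suc ∣ p ∣ + m                 ≡⟨ ℕₚ.+-suc ∣ p ∣ m ⟨
    ∣ p ∣ + suc m                 ∎
    where open ℕₚ.≤-Reasoning

  p⊆q⇒∣q∩∁p∣+∣p∣≡∣q∣ : ∀ {p q : Subset n} → p ⊆ q → ∣ q ∩ ∁ p ∣ + ∣ p ∣ ≡ ∣ q ∣
  p⊆q⇒∣q∩∁p∣+∣p∣≡∣q∣ {p = []}        {q = []}        _   = refl
  p⊆q⇒∣q∩∁p∣+∣p∣≡∣q∣ {p = true  ∷ p} {q = true  ∷ q} p⊆q =
    trans (ℕₚ.+-suc ∣ q ∩ ∁ p ∣ ∣ p ∣) (cong suc (p⊆q⇒∣q∩∁p∣+∣p∣≡∣q∣ (drop-∷-⊆ p⊆q)))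
  p⊆q⇒∣q∩∁p∣+∣p∣≡∣q∣ {p = true  ∷ p} {q = false ∷ q} p⊆q = contradiction (p⊆q here) λ ()
  p⊆q⇒∣q∩∁p∣+∣p∣≡∣q∣ {p = false ∷ p} {q = true  ∷ q} p⊆q = cong suc (p⊆q⇒∣q∩∁p∣+∣p∣≡∣q∣ (drop-∷-⊆ p⊆q))
  p⊆q⇒∣q∩∁p∣+∣p∣≡∣q∣ {p = false ∷ p} {q = false ∷ q} p⊆q = p⊆q⇒∣q∩∁p∣+∣p∣≡∣q∣ (drop-∷-⊆ p⊆q)

  p⊆q∧∣p∣≡∣q∣⇒p≡q : ∀ {p q : Subset n} → p ⊆ q → ∣ p ∣ ≡ ∣ q ∣ → p ≡ q
  p⊆q∧∣p∣≡∣q∣⇒p≡q {p = p} {q = q} p⊆q ∣p∣≡∣q∣ = ⊆-antisym p⊆q q⊆p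
    where
    ∣q∩∁p∣≡0 : ∣ q ∩ ∁ p ∣ ≡ 0
    ∣q∩∁p∣≡0 = ℕₚ.+-cancelʳ-≡ ∣ p ∣ _ 0 (trans (p⊆q⇒∣q∩∁p∣+∣p∣≡∣q∣ p⊆q) (sym ∣p∣≡∣q∣))
    q⊆p : q ⊆ p
    q⊆p {x} x∈q with x ∈? p
    ... | yes x∈p = x∈p
    ... | no  x∉p = contradiction (sym ∣q∩∁p∣≡0) (ℕₚ.<⇒≢ 0<∣q∩∁p∣)
      where
      ⁅x⁆⊆q∩∁p : ⁅ x ⁆ ⊆ q ∩ ∁ p
      ⁅x⁆⊆q∩∁p y∈⁅x⁆ = subst (_∈ q ∩ ∁ p) (sym (x∈⁅y⁆⇒x≡y x y∈⁅x⁆)) (x∈p∩q⁺ (x∈q , x∉p⇒x∈∁p x∉p))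
      0<∣q∩∁p∣ : 0 < ∣ q ∩ ∁ p ∣
      0<∣q∩∁p∣ = subst (_≤ ∣ q ∩ ∁ p ∣) (∣⁅x⁆∣≡1 x) (p⊆q⇒∣p∣≤∣q∣ ⁅x⁆⊆q∩∁p)

  -- The equality test of isEdge, so that isEdge (e ∷ E) s unfolds to (e ≡ᵇ s) ∨ isEdge E s.
  infix 4 _≡ᵇ_
  _≡ᵇ_ : Subset n → Subset n → Bool
  p ≡ᵇ q = ⌊ Vecₚ.≡-dec Bool._≟_ p q ⌋

  ≡ᵇ⇒≡ : ∀ {p q : Subset n} → (p ≡ᵇ q) ≡ true → p ≡ q
  ≡ᵇ⇒≡ {p = p} {q} eq with Vecₚ.≡-dec Bool._≟_ p q
  ... | yes p≡q = p≡q

  ≢⇒≡ᵇfalse : ∀ {p q : Subset n} → p ≢ q → (p ≡ᵇ q) ≡ false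
  ≢⇒≡ᵇfalse {p = p} {q} p≢q with Vecₚ.≡-dec Bool._≟_ p q
  ... | yes p≡q = contradiction p≡q p≢q
  ... | no  _   = refl

  ≡ᵇ-refl : ∀ (p : Subset n) → (p ≡ᵇ p) ≡ true
  ≡ᵇ-refl p with Vecₚ.≡-dec Bool._≟_ p p
  ... | yes _   = refl
  ... | no  p≢p = contradiction refl p≢p

  isEdge-true : ∀ (E : List (Subset n)) {s} → s ∈E E → isEdge E s ≡ true
  isEdge-true (e ∷ E) (here refl) rewrite ≡ᵇ-refl e = refl
  isEdge-true (e ∷ E) (there s∈E) rewrite isEdge-true E s∈E = Boolₚ.∨-zeroʳ (e ≡ᵇ _)

  isEdge-false : ∀ (E : List (Subset n)) {s} → All (_≢ s) E → isEdge E s ≡ false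
  isEdge-false []      []             = refl
  isEdge-false (e ∷ E) (e≢s ∷ E≢s) rewrite ≢⇒≡ᵇfalse e≢s = isEdge-false E E≢s

  degree-∷ : ∀ (e : Subset n) E i → degree (e ∷ E) i ≡ indicator (lookup e i) + degree E i
  degree-∷ e E i with lookup e i
  ... | true  = refl
  ... | false = refl

  count-covering-none : ∀ {p q : Subset n} → ∣ p ∣ + m < ∣ q ∣ →
                        count (λ xs → q ≡ᵇ p ∪ entries xs) (allIdx n m) ≡ 0
  count-covering-none {n} {m} {p} {q} ∣p∣+m<∣q∣ = count-none
    (λ xs → ≢⇒≡ᵇfalse λ q≡ →
      ℕₚ.<⇒≱ ∣p∣+m<∣q∣ (ℕₚ.≤-trans (ℕₚ.≤-reflexive (cong ∣_∣ q≡)) (∣p∪entries∣≤∣p∣+m p xs)))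
    (allIdx n m)

  -- The m ! index vectors counted are the orderings of q ∖ p.
  count-covering : ∀ {p q : Subset n} → p ⊆ q → ∣ p ∣ + m ≡ ∣ q ∣ →
                   count (λ xs → q ≡ᵇ p ∪ entries xs) (allIdx n m) ≡ m !
  count-covering {m = zero} {p = p} {q} p⊆q ∣p∣+0≡∣q∣ rewrite ∪-identityʳ p
    | p⊆q∧∣p∣≡∣q∣⇒p≡q p⊆q (trans (sym (ℕₚ.+-identityʳ ∣ p ∣)) ∣p∣+0≡∣q∣) | ≡ᵇ-refl q = refl
  count-covering {n} {suc m} {p} {q} p⊆q ∣p∣+1+m≡∣q∣ = begin
    count (λ xs → q ≡ᵇ p ∪ entries xs) (allIdx n (suc m))
      ≡⟨ count-allIdx-suc {n} {m} (λ xs → q ≡ᵇ p ∪ entries xs) ⟩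
    sum (map (λ x → count (λ xs → q ≡ᵇ p ∪ (⁅ x ⁆ ∪ entries xs)) (allIdx n m)) (allFin n))
      ≡⟨ sum-indicator _ (lookup (q ∩ ∁ p)) (m !) count-first (allFin n) ⟩
    count (lookup (q ∩ ∁ p)) (allFin n) * m !
      ≡⟨ cong (_* m !) (trans (count-lookup-allFin (q ∩ ∁ p)) ∣q∩∁p∣≡1+m) ⟩
    suc m * m ! ∎
    where
    open ≡-Reasoning
    ∣q∩∁p∣≡1+m : ∣ q ∩ ∁ p ∣ ≡ suc m
    ∣q∩∁p∣≡1+m = ℕₚ.+-cancelʳ-≡ ∣ p ∣ _ _
      (trans (p⊆q⇒∣q∩∁p∣+∣p∣≡∣q∣ p⊆q) (trans (sym ∣p∣+1+m≡∣q∣) (ℕₚ.+-comm ∣ p ∣ (suc m))))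
    count-first : ∀ x → count (λ xs → q ≡ᵇ p ∪ (⁅ x ⁆ ∪ entries xs)) (allIdx n m)
                        ≡ indicator (lookup (q ∩ ∁ p) x) * m !
    count-first x with x ∈? p | x ∈? q
    ... | yes x∈p | _ rewrite ∉⇒lookup≡false (x∈p⇒x∉∁p x∈p ∘ proj₂ ∘ x∈p∩q⁻ q (∁ p)) =
      trans (count-cong (λ xs → cong (q ≡ᵇ_) (trans (sym (∪-assoc p ⁅ x ⁆ (entries xs)))
                                                      (cong (_∪ entries xs) (x∈p⇒p∪⁅x⁆≡p x∈p)))) (allIdx n m))
            (count-covering-none {n} {m} {p} {q}
              (ℕₚ.≤-reflexive (trans (sym (ℕₚ.+-suc ∣ p ∣ m)) ∣p∣+1+m≡∣q∣)))
    ... | no x∉p | yes x∈q rewrite ∈⇒lookup≡true (x∈p∩q⁺ (x∈q , x∉p⇒x∈∁p x∉p)) =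
      trans (count-cong (λ xs → cong (q ≡ᵇ_) (sym (∪-assoc p ⁅ x ⁆ (entries xs)))) (allIdx n m))
            (trans (count-covering p∪⁅x⁆⊆q ∣p∪⁅x⁆∣+m≡∣q∣) (sym (ℕₚ.+-identityʳ (m !))))
      where
      p∪⁅x⁆⊆q : p ∪ ⁅ x ⁆ ⊆ q
      p∪⁅x⁆⊆q y∈ with x∈p∪q⁻ p ⁅ x ⁆ y∈
      ... | inj₁ y∈p    = p⊆q y∈p
      ... | inj₂ y∈⁅x⁆ = subst (_∈ q) (sym (x∈⁅y⁆⇒x≡y x y∈⁅x⁆)) x∈q
      ∣p∪⁅x⁆∣+m≡∣q∣ : ∣ p ∪ ⁅ x ⁆ ∣ + m ≡ ∣ q ∣
      ∣p∪⁅x⁆∣+m≡∣q∣ = trans (cong (_+ m) (x∉p⇒∣p∪⁅x⁆∣≡1+∣p∣ x∉p)) (trans (sym (ℕₚ.+-suc ∣ p ∣ m)) ∣p∣+1+m≡∣q∣)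
    ... | no _ | no x∉q rewrite ∉⇒lookup≡false (x∉q ∘ proj₁ ∘ x∈p∩q⁻ q (∁ p)) =
      count-none (λ xs → ≢⇒≡ᵇfalse λ q≡ → x∉q (subst (x ∈_) (sym q≡)
        (x∈p∪q⁺ (inj₂ (x∈p∪q⁺ (inj₁ (x∈⁅x⁆ x))))))) (allIdx n m)

  count-edge : ∀ {e : Subset n} i → ∣ e ∣ ≡ suc m →
               count (λ xs → e ≡ᵇ ⁅ i ⁆ ∪ entries xs) (allIdx n m) ≡ indicator (lookup e i) * m !
  count-edge {n} {m} {e} i ∣e∣≡1+m with i ∈? e
  ... | yes i∈e rewrite ∈⇒lookup≡true i∈e =
    trans (count-covering ⁅i⁆⊆e (trans (cong (_+ m) (∣⁅x⁆∣≡1 i)) (sym ∣e∣≡1+m))) (sym (ℕₚ.+-identityʳ (m !)))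
    where
    ⁅i⁆⊆e : ⁅ i ⁆ ⊆ e
    ⁅i⁆⊆e x∈⁅i⁆ = subst (_∈ e) (sym (x∈⁅y⁆⇒x≡y i x∈⁅i⁆)) i∈e
  ... | no i∉e rewrite ∉⇒lookup≡false i∉e =
    count-none (λ xs → ≢⇒≡ᵇfalse λ e≡ → i∉e (subst (i ∈_) (sym e≡) (x∈p∪q⁺ (inj₁ (x∈⁅x⁆ i))))) (allIdx n m)

  count-adjacent : ∀ {E : List (Subset n)} → Unique E → Uniform n (suc m) E → ∀ i →
                   count (λ xs → isEdge E (⁅ i ⁆ ∪ entries xs)) (allIdx n m) ≡ degree E i * m !
  count-adjacent {n} {m} {[]}    []               []               i = count-none (λ _ → refl) (allIdx n m)
  count-adjacent {n} {m} {e ∷ E} (e∉E ∷ unique) (∣e∣≡1+m ∷ uniform) i = begin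
    count (λ xs → (e ≡ᵇ ⁅ i ⁆ ∪ entries xs) ∨ isEdge E (⁅ i ⁆ ∪ entries xs)) (allIdx n m)
      ≡⟨ count-∨ _ _ (λ xs e≡ → isEdge-false E (All.map (λ e≢e′ e′≡ → e≢e′ (trans (≡ᵇ⇒≡ e≡) (sym e′≡))) e∉E))
                 (allIdx n m) ⟩
    count (λ xs → e ≡ᵇ ⁅ i ⁆ ∪ entries xs) (allIdx n m)
      + count (λ xs → isEdge E (⁅ i ⁆ ∪ entries xs)) (allIdx n m)
      ≡⟨ cong₂ _+_ (count-edge i ∣e∣≡1+m) (count-adjacent unique uniform i) ⟩
    indicator (lookup e i) * m ! + degree E i * m !
      ≡⟨ ℕₚ.*-distribʳ-+ (m !) (indicator (lookup e i)) (degree E i) ⟨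
    (indicator (lookup e i) + degree E i) * m !
      ≡⟨ cong (_* m !) (degree-∷ e E i) ⟨
    degree (e ∷ E) i * m ! ∎
    where open ≡-Reasoning

  EdgeClosed : ∀ {ℓ} → List (Subset n) → (Fin n → Set ℓ) → Set ℓ
  EdgeClosed E P = ∀ {e i j} → e ∈E E → lookup e i ≡ true → lookup e j ≡ true → P i → P j

  EdgeClosed-Path : ∀ {ℓ} {E : List (Subset n)} {P : Fin n → Set ℓ} → EdgeClosed E P →
                    ∀ {a b} → Path E a b → P a → P b
  EdgeClosed-Path {P = P} closed {a} path Pa = subst P end (along (Fin.fromℕ l))
    where
    open Path path
    along : ∀ j → P (v j)
    along = <-weakInduction (P ∘ v) (subst P (sym start) Pa) λ j → closed (e∈E j) (v-in-left j) (v-in-right j)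

  edge-as-row : ∀ {e : Subset n} {i} → ∣ e ∣ ≡ suc m → i ∈ e →
                ∃ λ xs → Any (xs ≡_) (allIdx n m) × e ≡ ⁅ i ⁆ ∪ entries xs
  edge-as-row {n} {m} {e} {i} ∣e∣≡1+m i∈e = map₂ (map₂ ≡ᵇ⇒≡) (count>0⇒∃ _ (allIdx n m) count>0)
    where
    count>0 : 0 < count (λ xs → e ≡ᵇ ⁅ i ⁆ ∪ entries xs) (allIdx n m)
    count>0 rewrite count-edge {e = e} i ∣e∣≡1+m | ∈⇒lookup≡true i∈e | ℕₚ.+-identityʳ (m !) = ℕₚ.1≤n! m

open Combinatorics

module OrderedField {c ℓ} (R : RealField c ℓ) where

  open RealField R public

  commutativeRing : CommutativeRing c ℓ
  commutativeRing = record { isCommutativeRing = isCommutativeRing }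

  open CommutativeRing commutativeRing public
    using (setoid; +-cong; *-cong; +-assoc; +-comm; +-identityˡ; +-identityʳ; -‿inverseˡ; -‿inverseʳ; -‿cong;
           *-assoc; *-comm; *-identityˡ; *-identityʳ; distribʳ; zeroˡ; zeroʳ)
    renaming (refl to ≈-refl; sym to ≈-sym; trans to ≈-trans; reflexive to ≈-reflexive)
  open RingProperties (CommutativeRing.ring commutativeRing) public
    using (-‿distribˡ-*; -‿involutive; -‿+-comm; -0#≈0#; x[y-z]≈xy-xz; [y-z]x≈yx-zx)
    renaming (x∙y⁻¹≈ε⇒x≈y to x-y≈0⇒x≈y; x≈y⇒x∙y⁻¹≈ε to x≈y⇒x-y≈0)
  open CommutativeSemigroupProperties (CommutativeRing.+-commutativeSemigroup commutativeRing) public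
    using () renaming (interchange to +-interchange)
  open IsTotalOrder isTotalOrder public
    using (total; antisym; ≤-respˡ-≈; ≤-respʳ-≈)
    renaming (refl to ≤-refl; trans to ≤-trans)
  module ≈-Reasoning = SetoidReasoning setoid

  x≤y⇒0≤y-x : ∀ {x y} → x ≤ y → 0# ≤ y - x
  x≤y⇒0≤y-x {x} p = ≤-respˡ-≈ (-‿inverseʳ x) (+-mono-≤ (- x) p)

  0≤y-x⇒x≤y : ∀ {x y} → 0# ≤ y - x → x ≤ y
  0≤y-x⇒x≤y {x} {y} p = ≤-respʳ-≈ y-x+x≈y (≤-respˡ-≈ (+-identityˡ x) (+-mono-≤ x p))
    where
    y-x+x≈y : y - x + x ≈ y
    y-x+x≈y = ≈-trans (+-assoc y (- x) x) (≈-trans (+-cong ≈-refl (-‿inverseˡ x)) (+-identityʳ y))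

  *-monoʳ-≤-nonneg : ∀ {a x y} → 0# ≤ a → x ≤ y → a * x ≤ a * y
  *-monoʳ-≤-nonneg {a} {x} {y} 0≤a x≤y =
    0≤y-x⇒x≤y (≤-respʳ-≈ (x[y-z]≈xy-xz a y x) (*-nonneg 0≤a (x≤y⇒0≤y-x x≤y)))

  0≤1 : 0# ≤ 1#
  0≤1 with total 0# 1#
  ... | inj₁ 0≤1 = 0≤1
  ... | inj₂ 1≤0 = ≤-respʳ-≈ -1*-1≈1 (*-nonneg 0≤-1 0≤-1)
    where
    0≤-1 : 0# ≤ - 1#
    0≤-1 = ≤-respʳ-≈ (+-identityˡ (- 1#)) (x≤y⇒0≤y-x 1≤0)
    -1*-1≈1 : - 1# * - 1# ≈ 1#
    -1*-1≈1 = ≈-trans (≈-sym (-‿distribˡ-* 1# (- 1#)))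
                      (≈-trans (-‿cong (*-identityˡ (- 1#))) (-‿involutive 1#))

  1≰0 : ¬ 1# ≤ 0#
  1≰0 1≤0 = 0≉1 (antisym 0≤1 1≤0)

  x≤x+y : ∀ {x y} → 0# ≤ y → x ≤ x + y
  x≤x+y {x} {y} 0≤y = ≤-respʳ-≈ (+-comm y x) (≤-respˡ-≈ (+-identityˡ x) (+-mono-≤ x 0≤y))

  x+y≈0⇒x≈0∧y≈0 : ∀ {x y} → 0# ≤ x → 0# ≤ y → x + y ≈ 0# → x ≈ 0# × y ≈ 0#
  x+y≈0⇒x≈0∧y≈0 {x} {y} 0≤x 0≤y x+y≈0 =
    antisym (≤-respʳ-≈ x+y≈0 (x≤x+y 0≤y)) 0≤x ,
    antisym (≤-respʳ-≈ (≈-trans (+-comm y x) x+y≈0) (x≤x+y 0≤x)) 0≤y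

  x*[x⁻¹*y]≈y : ∀ {x} y → ¬ x ≈ 0# → x * (x ⁻¹ * y) ≈ y
  x*[x⁻¹*y]≈y {x} y x≉0 = begin
    x * (x ⁻¹ * y)   ≈⟨ *-assoc x (x ⁻¹) y ⟨
    x * x ⁻¹ * y     ≈⟨ *-cong (⁻¹-inverse x x≉0) ≈-refl ⟩
    1# * y           ≈⟨ *-identityˡ y ⟩
    y                ∎
    where open ≈-Reasoning

  x⁻¹*[x*y]≈y : ∀ {x} y → ¬ x ≈ 0# → x ⁻¹ * (x * y) ≈ y
  x⁻¹*[x*y]≈y {x} y x≉0 = begin
    x ⁻¹ * (x * y)   ≈⟨ *-assoc (x ⁻¹) x y ⟨
    x ⁻¹ * x * y     ≈⟨ *-cong (≈-trans (*-comm (x ⁻¹) x) (⁻¹-inverse x x≉0)) ≈-refl ⟩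
    1# * y           ≈⟨ *-identityˡ y ⟩
    y                ∎
    where open ≈-Reasoning

  x*y≈0⇒y≈0 : ∀ {x y} → ¬ x ≈ 0# → x * y ≈ 0# → y ≈ 0#
  x*y≈0⇒y≈0 {x} {y} x≉0 xy≈0 =
    ≈-trans (≈-sym (x⁻¹*[x*y]≈y y x≉0)) (≈-trans (*-cong ≈-refl xy≈0) (zeroʳ (x ⁻¹)))

  x≉0∧y≉0⇒x*y≉0 : ∀ {x y} → ¬ x ≈ 0# → ¬ y ≈ 0# → ¬ x * y ≈ 0#
  x≉0∧y≉0⇒x*y≉0 x≉0 y≉0 = y≉0 ∘ x*y≈0⇒y≈0 x≉0

  *-cancelˡ-≈ : ∀ {a x y} → ¬ a ≈ 0# → a * x ≈ a * y → x ≈ y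
  *-cancelˡ-≈ {a} {x} {y} a≉0 ax≈ay =
    x-y≈0⇒x≈y x y (x*y≈0⇒y≈0 a≉0 (≈-trans (x[y-z]≈xy-xz a x y) (x≈y⇒x-y≈0 ax≈ay)))

  ⁻¹-nonneg : ∀ {x} → 0# ≤ x → ¬ x ≈ 0# → 0# ≤ x ⁻¹
  ⁻¹-nonneg {x} 0≤x x≉0 with total 0# (x ⁻¹)
  ... | inj₁ 0≤x⁻¹ = 0≤x⁻¹
  ... | inj₂ x⁻¹≤0 = contradiction
    (≤-respˡ-≈ (⁻¹-inverse x x≉0) (≤-respʳ-≈ (zeroʳ x) (*-monoʳ-≤-nonneg 0≤x x⁻¹≤0))) 1≰0

  ⁻¹-≉0 : ∀ {x} → ¬ x ≈ 0# → ¬ x ⁻¹ ≈ 0#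
  ⁻¹-≉0 {x} x≉0 x⁻¹≈0 =
    0≉1 (≈-trans (≈-sym (zeroʳ x)) (≈-trans (*-cong ≈-refl (≈-sym x⁻¹≈0)) (⁻¹-inverse x x≉0)))

  *-cancelˡ-≤-pos : ∀ {a x y} → 0# ≤ a → ¬ a ≈ 0# → a * x ≤ a * y → x ≤ y
  *-cancelˡ-≤-pos {a} {x} {y} 0≤a a≉0 ax≤ay = 0≤y-x⇒x≤y (≤-respʳ-≈ (x⁻¹*[x*y]≈y (y - x) a≉0)
    (≤-respʳ-≈ (*-cong ≈-refl (≈-sym (x[y-z]≈xy-xz a y x)))
      (≤-respˡ-≈ (zeroʳ (a ⁻¹)) (*-monoʳ-≤-nonneg (⁻¹-nonneg 0≤a a≉0) (x≤y⇒0≤y-x ax≤ay)))))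

  fromℕ : ℕ → Carrier
  fromℕ = fromℕ' R

  fromℕ-nonneg : ∀ m → 0# ≤ fromℕ m
  fromℕ-nonneg zero    = ≤-refl
  fromℕ-nonneg (suc m) = ≤-trans 0≤1 (x≤x+y (fromℕ-nonneg m))

  fromℕ-≉0 : ∀ {m} → 0 ℕ.< m → ¬ fromℕ m ≈ 0#
  fromℕ-≉0 {suc m} _ 1+m≈0 = 1≰0 (≤-respʳ-≈ 1+m≈0 (x≤x+y (fromℕ-nonneg m)))

  fromℕ-+ : ∀ a b → fromℕ (a ℕ.+ b) ≈ fromℕ a + fromℕ b
  fromℕ-+ zero    b = ≈-sym (+-identityˡ (fromℕ b))
  fromℕ-+ (suc a) b = ≈-trans (+-cong ≈-refl (fromℕ-+ a b)) (≈-sym (+-assoc 1# (fromℕ a) (fromℕ b)))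

  fromℕ-* : ∀ a b → fromℕ (a ℕ.* b) ≈ fromℕ a * fromℕ b
  fromℕ-* zero    b = ≈-sym (zeroˡ (fromℕ b))
  fromℕ-* (suc a) b = begin
    fromℕ (b ℕ.+ a ℕ.* b)        ≈⟨ fromℕ-+ b (a ℕ.* b) ⟩
    fromℕ b + fromℕ (a ℕ.* b)    ≈⟨ +-cong (≈-sym (*-identityˡ (fromℕ b))) (fromℕ-* a b) ⟩
    1# * fromℕ b + fromℕ a * fromℕ b ≈⟨ distribʳ (fromℕ b) 1# (fromℕ a) ⟨
    (1# + fromℕ a) * fromℕ b     ∎
    where open ≈-Reasoning

  infixr 8 _^_
  _^_ : Carrier → ℕ → Carrier
  x ^ zero  = 1#
  x ^ suc t = x * x ^ t

  ^-congˡ : ∀ {x y} t → x ≈ y → x ^ t ≈ y ^ t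
  ^-congˡ zero    x≈y = ≈-refl
  ^-congˡ (suc t) x≈y = *-cong x≈y (^-congˡ t x≈y)

  ^-nonneg : ∀ {x} t → 0# ≤ x → 0# ≤ x ^ t
  ^-nonneg zero    0≤x = 0≤1
  ^-nonneg (suc t) 0≤x = *-nonneg 0≤x (^-nonneg t 0≤x)

  ^-≉0 : ∀ {x} t → ¬ x ≈ 0# → ¬ x ^ t ≈ 0#
  ^-≉0 zero    x≉0 1≈0 = 0≉1 (≈-sym 1≈0)
  ^-≉0 (suc t) x≉0     = x≉0∧y≉0⇒x*y≉0 x≉0 (^-≉0 t x≉0)

  ∑ : ∀ {a} {A : Set a} → List A → (A → Carrier) → Carrier
  ∑ xs f = sumL R (map f xs)

  syntax ∑ xs (λ x → t) = ∑[ x ← xs ] t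

  module _ {a} {A : Set a} where

    ∑-cong : ∀ {f g : A → Carrier} → (∀ x → f x ≈ g x) → ∀ xs → ∑ xs f ≈ ∑ xs g
    ∑-cong f≈g []       = ≈-refl
    ∑-cong f≈g (x ∷ xs) = +-cong (f≈g x) (∑-cong f≈g xs)

    ∑-++ : ∀ (f : A → Carrier) xs ys → ∑ (xs ++ ys) f ≈ ∑ xs f + ∑ ys f
    ∑-++ f []       ys = ≈-sym (+-identityˡ (∑ ys f))
    ∑-++ f (x ∷ xs) ys = ≈-trans (+-cong ≈-refl (∑-++ f xs ys)) (≈-sym (+-assoc (f x) _ _))

    ∑-─ : ∀ (f g : A → Carrier) xs → ∑[ x ← xs ] (f x - g x) ≈ ∑ xs f - ∑ xs g
    ∑-─ f g []       = ≈-sym (≈-trans (+-cong ≈-refl -0#≈0#) (+-identityʳ 0#))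
    ∑-─ f g (x ∷ xs) = begin
      (f x - g x) + ∑[ x ← xs ] (f x - g x)   ≈⟨ +-cong ≈-refl (∑-─ f g xs) ⟩
      (f x - g x) + (∑ xs f - ∑ xs g)         ≈⟨ +-interchange (f x) (- g x) (∑ xs f) (- ∑ xs g) ⟩
      (f x + ∑ xs f) + ((- g x) - ∑ xs g)     ≈⟨ +-cong ≈-refl (-‿+-comm (g x) (∑ xs g)) ⟩
      (f x + ∑ xs f) - (g x + ∑ xs g)         ∎
      where open ≈-Reasoning

    ∑-zero : ∀ {f : A → Carrier} → (∀ x → f x ≈ 0#) → ∀ xs → ∑ xs f ≈ 0#
    ∑-zero f≈0 []       = ≈-refl
    ∑-zero f≈0 (x ∷ xs) = ≈-trans (+-cong (f≈0 x) (∑-zero f≈0 xs)) (+-identityˡ 0#)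

    ∑-nonneg : ∀ {f : A → Carrier} → (∀ x → 0# ≤ f x) → ∀ xs → 0# ≤ ∑ xs f
    ∑-nonneg 0≤f []       = ≤-refl
    ∑-nonneg 0≤f (x ∷ xs) = ≤-trans (0≤f x) (x≤x+y (∑-nonneg 0≤f xs))

    ∑-nonneg≈0⇒≈0 : ∀ {f : A → Carrier} → (∀ x → 0# ≤ f x) → ∀ xs → ∑ xs f ≈ 0# →
                    ∀ {y} → Any (y ≡_) xs → f y ≈ 0#
    ∑-nonneg≈0⇒≈0 0≤f (x ∷ xs) ∑≈0 (here refl) = proj₁ (x+y≈0⇒x≈0∧y≈0 (0≤f x) (∑-nonneg 0≤f xs) ∑≈0)
    ∑-nonneg≈0⇒≈0 0≤f (x ∷ xs) ∑≈0 (there y∈xs) =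
      ∑-nonneg≈0⇒≈0 0≤f xs (proj₂ (x+y≈0⇒x≈0∧y≈0 (0≤f x) (∑-nonneg 0≤f xs) ∑≈0)) y∈xs

    ∑-indicator : ∀ (p : A → Bool) a k xs →
                  ∑[ x ← xs ] ((if p x then a else 0#) * k) ≈ fromℕ (count p xs) * (a * k)
    ∑-indicator p a k []       = ≈-sym (zeroˡ (a * k))
    ∑-indicator p a k (x ∷ xs) with p x
    ... | true  =
      ≈-trans (+-cong (≈-sym (*-identityˡ (a * k))) (∑-indicator p a k xs)) (≈-sym (distribʳ _ _ _))
    ... | false = ≈-trans (+-cong (zeroˡ k) (∑-indicator p a k xs)) (+-identityˡ _)

  ∑-concatMap : ∀ {a b} {A : Set a} {B : Set b} (f : A → List B) (g : B → Carrier) xs →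
                ∑ (concatMap f xs) g ≈ ∑[ x ← xs ] ∑ (f x) g
  ∑-concatMap f g []       = ≈-refl
  ∑-concatMap f g (x ∷ xs) = ≈-trans (∑-++ g (f x) (concatMap f xs)) (+-cong ≈-refl (∑-concatMap f g xs))

  ∑-allIdx-suc : ∀ {n t} (g : Vec (Fin n) (suc t) → Carrier) →
                 ∑ (allIdx n (suc t)) g ≈ ∑[ j ← allFin n ] ∑[ xs ← allIdx n t ] g (j ∷ xs)
  ∑-allIdx-suc {n} {t} g = ≈-trans (∑-concatMap (λ j → map (j ∷_) (allIdx n t)) g (allFin n))
    (∑-cong (λ j → ≈-reflexive (cong (sumL R) (sym (Listₚ.map-∘ (allIdx n t))))) (allFin n))

  ∑-allFin-suc : ∀ {n} (f : Fin (suc n) → Carrier) → ∑ (allFin (suc n)) f ≈ f zero + ∑ (allFin n) (f ∘ suc)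
  ∑-allFin-suc {n} f = ≈-reflexive (cong (sumL R)
    (trans (cong (map f) (allFin-suc n)) (cong (f zero ∷_) (sym (Listₚ.map-∘ (allFin n))))))

  ∑-allFin-single : ∀ {n} (f : Fin n → Carrier) i → (∀ j → j ≢ i → f j ≈ 0#) → ∑ (allFin n) f ≈ f i
  ∑-allFin-single {suc n} f zero    f≈0 = begin
    ∑ (allFin (suc n)) f          ≈⟨ ∑-allFin-suc f ⟩
    f zero + ∑ (allFin n) (f ∘ suc) ≈⟨ +-cong ≈-refl (∑-zero (λ j → f≈0 (suc j) λ ()) (allFin n)) ⟩
    f zero + 0#                   ≈⟨ +-identityʳ (f zero) ⟩
    f zero                        ∎
    where open ≈-Reasoning
  ∑-allFin-single {suc n} f (suc i) f≈0 = begin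
    ∑ (allFin (suc n)) f          ≈⟨ ∑-allFin-suc f ⟩
    f zero + ∑ (allFin n) (f ∘ suc) ≈⟨ +-cong (f≈0 zero λ ()) (∑-allFin-single (f ∘ suc) i f∘suc≈0) ⟩
    0# + f (suc i)                ≈⟨ +-identityˡ (f (suc i)) ⟩
    f (suc i)                     ∎
    where
    open ≈-Reasoning
    f∘suc≈0 : ∀ j → j ≢ i → f (suc j) ≈ 0#
    f∘suc≈0 j j≢i = f≈0 (suc j) (j≢i ∘ Finₚ.suc-injective)

  ∑-diagonal : ∀ {n} (i : Fin n) t (g : Vec (Fin n) t → Carrier) →
               ∑[ xs ← allIdx n t ] (if allEq i xs then g xs else 0#) ≈ g (Vec.replicate t i)
  ∑-diagonal i zero    g = +-identityʳ (g [])
  ∑-diagonal {n} i (suc t) g = begin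
    ∑[ xs ← allIdx n (suc t) ] (if allEq i xs then g xs else 0#)
      ≈⟨ ∑-allIdx-suc (λ xs → if allEq i xs then g xs else 0#) ⟩
    ∑[ j ← allFin n ] ∑[ xs ← allIdx n t ] (if allEq i (j ∷ xs) then g (j ∷ xs) else 0#)
      ≈⟨ ∑-allFin-single _ i off-diagonal ⟩
    ∑[ xs ← allIdx n t ] (if allEq i (i ∷ xs) then g (i ∷ xs) else 0#)
      ≈⟨ ∑-cong on-diagonal (allIdx n t) ⟩
    ∑[ xs ← allIdx n t ] (if allEq i xs then g (i ∷ xs) else 0#)
      ≈⟨ ∑-diagonal i t (g ∘ (i ∷_)) ⟩
    g (Vec.replicate (suc t) i) ∎
    where
    open ≈-Reasoning
    off-diagonal : ∀ j → j ≢ i → ∑[ xs ← allIdx n t ] (if allEq i (j ∷ xs) then g (j ∷ xs) else 0#) ≈ 0#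
    off-diagonal j j≢i = ∑-zero term (allIdx n t)
      where
      term : ∀ xs → (if allEq i (j ∷ xs) then g (j ∷ xs) else 0#) ≈ 0#
      term xs with i Fin.≟ j
      ... | yes i≡j = contradiction (sym i≡j) j≢i
      ... | no  _   = ≈-refl
    on-diagonal : ∀ xs → (if allEq i (i ∷ xs) then g (i ∷ xs) else 0#)
                         ≈ (if allEq i xs then g (i ∷ xs) else 0#)
    on-diagonal xs with i Fin.≟ i
    ... | yes _   = ≈-refl
    ... | no  i≢i = contradiction refl i≢i

  argmax : ∀ {n} (x : Fin (suc n) → Carrier) → Σ (Fin (suc n)) λ u → ∀ j → x j ≤ x u
  argmax {zero}  x = zero , λ { zero → ≤-refl }
  argmax {suc n} x with argmax (x ∘ suc)
  ... | u , x∘suc≤ with total (x zero) (x (suc u))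
  ...   | inj₁ x₀≤ = suc u , λ { zero → x₀≤ ; (suc j) → x∘suc≤ j }
  ...   | inj₂ ≤x₀ = zero  , λ { zero → ≤-refl ; (suc j) → ≤-trans (x∘suc≤ j) ≤x₀ }

  monomial : ∀ {n t} → (Fin n → Carrier) → Vec (Fin n) t → Carrier
  monomial x xs = prodL R (map x (Vec.toList xs))

  monomial-replicate : ∀ {n} (x : Fin n → Carrier) i t → monomial x (Vec.replicate t i) ≈ x i ^ t
  monomial-replicate x i zero    = ≈-refl
  monomial-replicate x i (suc t) = *-cong ≈-refl (monomial-replicate x i t)

  module _ {n} {x : Fin n → Carrier} {M} (x-nonneg : ∀ j → 0# ≤ x j) (x≤M : ∀ j → x j ≤ M) where

    monomial-≤ : ∀ {t} (xs : Vec (Fin n) t) → monomial x xs ≤ M ^ t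
    monomial-≤ []       = ≤-refl
    monomial-≤ {suc t} (y ∷ ys) = ≤-trans (*-monoʳ-≤-nonneg (x-nonneg y) (monomial-≤ ys))
      (≤-respˡ-≈ (*-comm _ _) (≤-respʳ-≈ (*-comm _ _) (*-monoʳ-≤-nonneg (^-nonneg t 0≤M) (x≤M y))))
      where
      0≤M : 0# ≤ M
      0≤M = ≤-trans (x-nonneg y) (x≤M y)

    monomial-∷≈M^[1+t] : ¬ M ≈ 0# → ∀ {t} y (ys : Vec (Fin n) t) → monomial x (y ∷ ys) ≈ M ^ suc t →
                         x y ≈ M × monomial x ys ≈ M ^ t
    monomial-∷≈M^[1+t] M≉0 {t} y ys x[y∷ys]≈M^[1+t] = xy≈M , x[ys]≈M^t
      where
      0≤M = ≤-trans (x-nonneg y) (x≤M y)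
      M≤xy : M ≤ x y
      M≤xy = *-cancelˡ-≤-pos (^-nonneg t 0≤M) (^-≉0 t M≉0)
        (≤-respˡ-≈ (≈-trans x[y∷ys]≈M^[1+t] (*-comm M (M ^ t)))
          (≤-respʳ-≈ (*-comm (x y) (M ^ t)) (*-monoʳ-≤-nonneg (x-nonneg y) (monomial-≤ ys))))
      xy≈M : x y ≈ M
      xy≈M = antisym (x≤M y) M≤xy
      x[ys]≈M^t : monomial x ys ≈ M ^ t
      x[ys]≈M^t = *-cancelˡ-≈ M≉0 (≈-trans (*-cong (≈-sym xy≈M) ≈-refl) x[y∷ys]≈M^[1+t])

    monomial≈M^t⇒maximal : ¬ M ≈ 0# → ∀ {t} (xs : Vec (Fin n) t) → monomial x xs ≈ M ^ t →
                            ∀ {j} → j ∈ entries xs → x j ≈ M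
    monomial≈M^t⇒maximal M≉0 []       _ j∈⊥ = contradiction j∈⊥ ∉⊥
    monomial≈M^t⇒maximal M≉0 (y ∷ ys) x[y∷ys]≈M^[1+t] j∈ with monomial-∷≈M^[1+t] M≉0 y ys x[y∷ys]≈M^[1+t]
                                                          | x∈p∪q⁻ ⁅ y ⁆ (entries ys) j∈
    ... | xy≈M , _        | inj₁ j∈⁅y⁆ = ≈-trans (≈-reflexive (cong x (x∈⁅y⁆⇒x≡y y j∈⁅y⁆))) xy≈M
    ... | _    , x[ys]≈M^t | inj₂ j∈ys  = monomial≈M^t⇒maximal M≉0 ys x[ys]≈M^t j∈ys

module UniformLaplacian {c ℓ} (R : RealField c ℓ) {n m : ℕ} (E : List (Subset n))
                        (unique : Unique E) (uniform : Uniform n (suc m) E) where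

  open OrderedField R

  L A D : Tensor R (suc m) n
  L = laplacian R n (suc m) E
  A = adjacency R n (suc m) E
  D = degreeTensor R n (suc m) E

  d : Fin n → Carrier
  d i = fromℕ (degree E i)

  1/m! : Carrier
  1/m! = fromℕ (m !) ⁻¹

  m!≉0 : ¬ fromℕ (m !) ≈ 0#
  m!≉0 = fromℕ-≉0 (ℕₚ.1≤n! m)

  A-nonneg : ∀ xs → 0# ≤ A xs
  A-nonneg xs with isEdge E (entries xs)
  ... | true  = ⁻¹-nonneg (fromℕ-nonneg (m !)) m!≉0
  ... | false = ≤-refl

  ∑-A-row : ∀ i a → ∑[ xs ← allIdx n m ] (A (i ∷ xs) * a) ≈ d i * a
  ∑-A-row i a = begin
    ∑[ xs ← allIdx n m ] (A (i ∷ xs) * a)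
      ≈⟨ ∑-indicator (λ xs → isEdge E (⁅ i ⁆ ∪ entries xs)) 1/m! a (allIdx n m) ⟩
    fromℕ (count (λ xs → isEdge E (⁅ i ⁆ ∪ entries xs)) (allIdx n m)) * (1/m! * a)
      ≈⟨ *-cong (≈-reflexive (cong fromℕ (count-adjacent unique uniform i))) ≈-refl ⟩
    fromℕ (degree E i ℕ.* m !) * (1/m! * a)
      ≈⟨ *-cong (fromℕ-* (degree E i) (m !)) ≈-refl ⟩
    d i * fromℕ (m !) * (1/m! * a)
      ≈⟨ *-assoc (d i) (fromℕ (m !)) (1/m! * a) ⟩
    d i * (fromℕ (m !) * (1/m! * a))
      ≈⟨ *-cong ≈-refl (x*[x⁻¹*y]≈y a m!≉0) ⟩
    d i * a ∎
    where open ≈-Reasoning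

  ∑-D-row : ∀ i (f : Vec (Fin n) m → Carrier) →
            ∑[ xs ← allIdx n m ] (D (i ∷ xs) * f xs) ≈ d i * f (Vec.replicate m i)
  ∑-D-row i f = ≈-trans (∑-cong D-diagonal (allIdx n m)) (∑-diagonal i m (λ xs → d i * f xs))
    where
    D-diagonal : ∀ xs → D (i ∷ xs) * f xs ≈ (if allEq i xs then d i * f xs else 0#)
    D-diagonal xs with allEq i xs
    ... | true  = ≈-refl
    ... | false = zeroˡ (f xs)

  L-apply : ∀ x i → apply R L x i ≈ (d i * x i ^ m) - apply R A x i
  L-apply x i = begin
    ∑[ xs ← allIdx n m ] ((D (i ∷ xs) - A (i ∷ xs)) * monomial x xs)
      ≈⟨ ∑-cong (λ xs → [y-z]x≈yx-zx (monomial x xs) (D (i ∷ xs)) (A (i ∷ xs))) (allIdx n m) ⟩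
    ∑[ xs ← allIdx n m ] ((D (i ∷ xs) * monomial x xs) - (A (i ∷ xs) * monomial x xs))
      ≈⟨ ∑-─ _ _ (allIdx n m) ⟩
    (∑[ xs ← allIdx n m ] (D (i ∷ xs) * monomial x xs)) - apply R A x i
      ≈⟨ +-cong (≈-trans (∑-D-row i (monomial x)) (*-cong ≈-refl (monomial-replicate x i m))) ≈-refl ⟩
    (d i * x i ^ m) - apply R A x i ∎
    where open ≈-Reasoning

  L-apply-𝟏 : ∀ i → apply R L (λ _ → 1#) i ≈ 0#
  L-apply-𝟏 i = ≈-trans (L-apply 𝟏 i) (x≈y⇒x-y≈0 (begin
    d i * 1# ^ m                            ≈⟨ *-cong ≈-refl (monomial-replicate 𝟏 i m) ⟨
    d i * monomial 𝟏 (Vec.replicate m i)    ≈⟨ *-cong ≈-refl (monomial-𝟏 (Vec.replicate m i)) ⟩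
    d i * 1#                                ≈⟨ ∑-A-row i 1# ⟨
    ∑[ xs ← allIdx n m ] (A (i ∷ xs) * 1#)  ≈⟨ ∑-cong (λ xs → *-cong ≈-refl (monomial-𝟏 xs)) (allIdx n m) ⟨
    apply R A 𝟏 i                           ∎))
    where
    open ≈-Reasoning
    𝟏 : Fin n → Carrier
    𝟏 _ = 1#
    monomial-𝟏 : ∀ {t} (xs : Vec (Fin n) t) → monomial 𝟏 xs ≈ 1#
    monomial-𝟏 []       = ≈-refl
    monomial-𝟏 (_ ∷ xs) = ≈-trans (*-identityˡ _) (monomial-𝟏 xs)

  module _ {x : Fin n → Carrier} (x-nonneg : ∀ j → 0# ≤ x j) (x-kernel : ∀ i → apply R L x i ≈ 0#)
           {M} (x≤M : ∀ j → x j ≤ M) (M≉0 : ¬ M ≈ 0#) where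

    deficit : Fin n → Vec (Fin n) m → Carrier
    deficit i xs = A (i ∷ xs) * ((M ^ m) - monomial x xs)

    deficit-nonneg : ∀ i xs → 0# ≤ deficit i xs
    deficit-nonneg i xs = *-nonneg (A-nonneg (i ∷ xs)) (x≤y⇒0≤y-x (monomial-≤ x-nonneg x≤M xs))

    ∑-deficit≈0 : ∀ {i} → x i ≈ M → ∑[ xs ← allIdx n m ] deficit i xs ≈ 0#
    ∑-deficit≈0 {i} xi≈M = begin
      ∑[ xs ← allIdx n m ] deficit i xs
        ≈⟨ ∑-cong (λ xs → x[y-z]≈xy-xz (A (i ∷ xs)) (M ^ m) (monomial x xs)) (allIdx n m) ⟩
      ∑[ xs ← allIdx n m ] ((A (i ∷ xs) * M ^ m) - (A (i ∷ xs) * monomial x xs))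
        ≈⟨ ∑-─ _ _ (allIdx n m) ⟩
      (∑[ xs ← allIdx n m ] (A (i ∷ xs) * M ^ m)) - apply R A x i
        ≈⟨ +-cong (∑-A-row i (M ^ m)) (-‿cong balance) ⟩
      (d i * M ^ m) - (d i * x i ^ m)
        ≈⟨ x≈y⇒x-y≈0 (*-cong ≈-refl (^-congˡ m (≈-sym xi≈M))) ⟩
      0# ∎
      where
      open ≈-Reasoning
      balance : apply R A x i ≈ d i * x i ^ m
      balance = ≈-sym (x-y≈0⇒x≈y _ _ (≈-trans (≈-sym (L-apply x i)) (x-kernel i)))

    row-maximal : ∀ {i xs} → x i ≈ M → isEdge E (⁅ i ⁆ ∪ entries xs) ≡ true → Any (xs ≡_) (allIdx n m) →
                  ∀ {j} → j ∈ entries xs → x j ≈ M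
    row-maximal {i} {xs} xi≈M edge xs∈ = monomial≈M^t⇒maximal x-nonneg x≤M M≉0 xs monomial≈M^m
      where
      A≡1/m! : A (i ∷ xs) ≡ 1/m!
      A≡1/m! rewrite edge = refl
      deficit≈0 : 1/m! * ((M ^ m) - monomial x xs) ≈ 0#
      deficit≈0 = subst (λ a → a * ((M ^ m) - monomial x xs) ≈ 0#) A≡1/m!
        (∑-nonneg≈0⇒≈0 (deficit-nonneg i) (allIdx n m) (∑-deficit≈0 xi≈M) xs∈)
      monomial≈M^m : monomial x xs ≈ M ^ m
      monomial≈M^m = ≈-sym (x-y≈0⇒x≈y _ _ (x*y≈0⇒y≈0 (⁻¹-≉0 m!≉0) deficit≈0))

    maximum-EdgeClosed : EdgeClosed E (λ j → x j ≈ M)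
    maximum-EdgeClosed {e} {i} {j} e∈E e∋i e∋j xi≈M
      with xs , xs∈ , e≡ ← edge-as-row (All.lookup uniform e∈E) (Vecₚ.lookup⇒[]= i e e∋i)
      with x∈p∪q⁻ ⁅ i ⁆ (entries xs) (subst (j ∈_) e≡ (Vecₚ.lookup⇒[]= j e e∋j))
    ... | inj₁ j∈⁅i⁆ = ≈-trans (≈-reflexive (cong x (x∈⁅y⁆⇒x≡y i j∈⁅i⁆))) xi≈M
    ... | inj₂ j∈xs  = row-maximal xi≈M (isEdge-true E (subst (_∈E E) e≡ e∈E)) xs∈ j∈xs

module ConnectedUniformLaplacian {c ℓ} (R : RealField c ℓ) {n m : ℕ} {E : List (Subset (suc n))}
  (unique : Unique E) (uniform : Uniform (suc n) (suc m) E) (connected : Connected (suc n) E) where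

  open OrderedField R
  open UniformLaplacian R E unique uniform

  NonnegKernel : (Fin (suc n) → Carrier) → Set ℓ
  NonnegKernel = NonnegKernelVec R (suc n) (suc m) E

  NonnegKernel-constant : ∀ {x} → NonnegKernel x → ∀ w → x w ≈ x zero
  NonnegKernel-constant {x} (x-nonneg , x≉0 , x-kernel) w = ≈-trans (maximal w) (≈-sym (maximal zero))
    where
    u = proj₁ (argmax x)
    x≤xu = proj₂ (argmax x)
    xu≉0 : ¬ x u ≈ 0#
    xu≉0 xu≈0 = x≉0 λ j → antisym (≤-respʳ-≈ xu≈0 (x≤xu j)) (x-nonneg j)
    maximal : ∀ w → x w ≈ x u
    maximal w = EdgeClosed-Path (maximum-EdgeClosed x-nonneg x-kernel x≤xu xu≉0) (connected u w) ≈-refl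

  NonnegKernel-proportional : ∀ {x y} → NonnegKernel x → NonnegKernel y → ∀ i → y zero * x i ≈ x zero * y i
  NonnegKernel-proportional {x} {y} x-kernel y-kernel i = begin
    y zero * x i     ≈⟨ *-cong ≈-refl (NonnegKernel-constant x-kernel i) ⟩
    y zero * x zero  ≈⟨ *-comm (y zero) (x zero) ⟩
    x zero * y zero  ≈⟨ *-cong ≈-refl (NonnegKernel-constant y-kernel i) ⟨
    x zero * y i     ∎
    where open ≈-Reasoning

  𝟏-NonnegKernel : NonnegKernel (λ _ → 1#)
  𝟏-NonnegKernel = (λ _ → 0≤1) , (λ 𝟏≈0 → 0≉1 (≈-sym (𝟏≈0 zero))) , L-apply-𝟏

  𝟏-HasIndepFamily : HasIndepFamily R (suc n) (suc m) E 1
  𝟏-HasIndepFamily = (λ _ _ → 1#) , (λ _ → 𝟏-NonnegKernel) , independent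
    where
    independent : LinIndep R {m = 1} (λ _ _ → 1#)
    independent a ∑≈0 zero = ≈-trans (≈-sym (≈-trans (+-identityʳ _) (*-identityʳ (a zero)))) (∑≈0 zero)

  HasIndepFamily⇒≤1 : ∀ t → HasIndepFamily R (suc n) (suc m) E t → t ℕ.≤ 1
  HasIndepFamily⇒≤1 zero          _ = z≤n
  HasIndepFamily⇒≤1 (suc zero)    _ = s≤s z≤n
  HasIndepFamily⇒≤1 (suc (suc t)) (v , v-kernel , independent) =
    contradiction (λ w → ≈-trans (NonnegKernel-constant v₁-kernel w) v₁0≈0) (proj₁ (proj₂ v₁-kernel))
    where
    v₀ = v zero
    v₁ = v (suc zero)
    v₁-kernel = v-kernel (suc zero)
    a : Fin (suc (suc t)) → Carrier
    a zero          = v₁ zero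
    a (suc zero)    = - v₀ zero
    a (suc (suc _)) = 0#
    combination≈0 : ∀ i → ∑[ j ← allFin (suc (suc t)) ] (a j * v j i) ≈ 0#
    combination≈0 i = begin
      ∑[ j ← allFin (suc (suc t)) ] (a j * v j i)
        ≈⟨ ∑-allFin-suc (λ j → a j * v j i) ⟩
      v₁ zero * v₀ i + ∑[ j ← allFin (suc t) ] (a (suc j) * v (suc j) i)
        ≈⟨ +-cong ≈-refl (∑-allFin-suc (λ j → a (suc j) * v (suc j) i)) ⟩
      v₁ zero * v₀ i + ((- v₀ zero) * v₁ i + ∑[ j ← allFin t ] (0# * v (suc (suc j)) i))
        ≈⟨ +-cong ≈-refl (≈-trans (+-cong ≈-refl (∑-zero (λ j → zeroˡ _) (allFin t))) (+-identityʳ _)) ⟩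
      v₁ zero * v₀ i + (- v₀ zero) * v₁ i
        ≈⟨ +-cong (NonnegKernel-proportional (v-kernel zero) v₁-kernel i) (≈-sym (-‿distribˡ-* (v₀ zero) (v₁ i))) ⟩
      (v₀ zero * v₁ i) - (v₀ zero * v₁ i)
        ≈⟨ -‿inverseʳ (v₀ zero * v₁ i) ⟩
      0# ∎
      where open ≈-Reasoning
    v₁0≈0 : v₁ zero ≈ 0#
    v₁0≈0 = independent a combination≈0 zero

  β≡1 : GeometryConnectivityIs R (suc n) (suc m) E 1
  β≡1 = 𝟏-HasIndepFamily , HasIndepFamily⇒≤1

open import Data.Nat using (_≤_)

lemma3p1 : ∀ {c ℓ} (R : RealField c ℓ) (n k : ℕ) → 1 ≤ n → 2 ≤ k →
    (E : List (Subset n)) → Unique E → Uniform n k E → Connected n E →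
    GeometryConnectivityIs R n k E 1
lemma3p1 R (suc n) (suc m) _ (s≤s _) E unique uniform connected =
  ConnectedUniformLaplacian.β≡1 R unique uniform connected
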